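{- Let $a\ge1$ be an odd integer and $m\ge 2$ an integer with $m\equiv 2\pmod 4$. Then $$\liminf_{n\to \infty}\frac{\#\{1\le k\le n\mid\mathrm{cp}_{a,a,m}(k) \text{ is even}\}}{n}\ge\frac{3}{4}.$$
   Context: For integers $a,b,m\ge1$, an $(a,b,m)$-copartition is a triple of integer partitions $(\gamma,\rho,\sigma)$ such that every part of $\gamma$ is $\ge a$ and $\equiv a \pmod m$, every part of $\sigma$ is $\ge b$ and $\equiv b\pmod m$, and $\rho$ has exactly as many parts as $\sigma$, each part of $\rho$ being equal to $m$ times the number of parts of $\gamma$. Its size is the sum of all parts of $\gamma,\rho,\sigma$, and $\mathrm{cp}_{a,b,m}(n)$ denotes the number of $(a,b,m)$-copartitions of size $n$. -}

module Defs where

open import Data.Nat using (ℕ; zero; suc; _+_; _*_; _∸_; _≤_; _≤?_)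
open import Data.Nat.Divisibility using (_∣_; _∣?_)
open import Data.List using (List; []; _∷_; [_]; map; concatMap; filter; length; replicate; applyUpTo; upTo)
open import Data.List.Relation.Unary.All using (All; all?)
open import Data.Product using (_×_; _,_; proj₁; proj₂)
open import Relation.Nullary using (Dec; _×-dec_)
open import Relation.Binary.PropositionalEquality using (_≡_)
import Data.Nat.Properties as ℕP
open import Data.Nat.ListAction using (sum)

-- Integer partitions are represented as non-increasing lists of positive parts.
-- ptsAux fuel b n : all partitions of n with every part ≤ b (fuel ≥ n suffices).
ptsAux : ℕ → ℕ → ℕ → List (List ℕ)
ptsAux _ _ zero = [ [] ]
ptsAux zero _ (suc n) = []
ptsAux (suc f) b (suc n) =
  concatMap (λ k → map (k ∷_) (ptsAux f k (suc n ∸ k)))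
            (filter (λ k → k ≤? suc n) (applyUpTo suc b))

partitions : ℕ → List (List ℕ)
partitions n = ptsAux n n n

PartOK : ℕ → ℕ → ℕ → Set
PartOK c m x = (c ≤ x) × (m ∣ (x ∸ c))

partOK? : ∀ c m x → Dec (PartOK c m x)
partOK? c m x = (c ≤? x) ×-dec (m ∣? (x ∸ c))

-- ρ is determined by γ and σ: length σ copies of m * (number of parts of γ)
rhoOf : ℕ → List ℕ → List ℕ → List ℕ
rhoOf m γ σ = replicate (length σ) (m * length γ)

-- (γ, σ) together with ρ = rhoOf m γ σ is an (a,b,m)-copartition of size n
IsCop : ℕ → ℕ → ℕ → ℕ → List ℕ × List ℕ → Set
IsCop a b m n (γ , σ) =
  All (PartOK a m) γ × All (PartOK b m) σ × (sum γ + sum (rhoOf m γ σ) + sum σ ≡ n)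

isCop? : ∀ a b m n p → Dec (IsCop a b m n p)
isCop? a b m n (γ , σ) =
  all? (partOK? a m) γ ×-dec (all? (partOK? b m) σ ×-dec
    (sum γ + sum (rhoOf m γ σ) + sum σ ℕP.≟ n))

candidates : ℕ → List (List ℕ × List ℕ)
candidates n =
  concatMap (λ i → concatMap (λ j →
     concatMap (λ γ → map (γ ,_) (partitions j)) (partitions i))
     (upTo (suc n))) (upTo (suc n))

cp : ℕ → ℕ → ℕ → ℕ → ℕ
cp a b m n = length (filter (isCop? a b m n) (candidates n))

evenCount : ℕ → ℕ → ℕ → ℕ
evenCount a m n = length (filter (λ k → 2 ∣? cp a a m k) (applyUpTo suc n))

{-# OPTIONS --safe #-}
-- Swapping γ and σ is an involution on the (a,a,m)-copartitions of n. A fixed point (γ,γ)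
-- has size 2 Σγ + m |γ|²; its parts are ≡ a (mod m), hence odd, so Σγ ≡ |γ| (mod 2), and
-- with m ≡ 2 (mod 4) the size is ≡ 2 |γ| (|γ| + 1) ≡ 0 (mod 4). Hence cp_{a,a,m}(n) is even whenever 4 ∤ n,
-- and at least three quarters of 1, …, n qualify for every n, not only asymptotically.
module Submission where

open import Defs
open import Data.List using (List; []; _∷_; _++_; [_]; map; concatMap; filter; length; replicate; applyUpTo; upTo)
open import Data.List.Properties using (filter-++; filter-all; length-++; length-applyUpTo)
open import Data.List.Relation.Unary.All using (All; []; _∷_)
import Data.List.Relation.Unary.All as All
open import Data.List.Relation.Unary.All.Properties using (applyUpTo⁺₁)
open import Data.Nat using (ℕ; zero; suc; _+_; _*_; _∸_; _≤_; _<_; _%_; _/_; s≤s; s≤s⁻¹; NonZero)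
open import Data.Nat.Properties
open import Data.Nat.DivMod using (m≡m%n+[m/n]*n; m%n<n)
open import Data.Nat.Divisibility
  using (_∣_; _∤_; divides; _∣0; _∣?_; ∣-trans; ∣m∣n⇒∣m+n; ∣m+n∣m⇒∣n; >⇒∤; ∣-refl; m∣m*n; *-monoʳ-∣)
open import Data.Nat.ListAction using (sum)
open import Data.Nat.Tactic.RingSolver using (solve-∀)
open import Data.Product using (_×_; _,_; proj₁; proj₂; ∃-syntax)
open import Function using (_∘_)
open import Relation.Binary.PropositionalEquality using (_≡_; refl; sym; trans; cong; cong₂; subst; subst₂; module ≡-Reasoning)
open import Relation.Nullary using (Dec; yes; no; ¬_; contradiction)
open import Relation.Unary using (Pred; Decidable)

module _ {A : Set} where

  ∑ : List A → (A → ℕ) → ℕ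
  ∑ []       f = 0
  ∑ (x ∷ xs) f = f x + ∑ xs f

  ∑-cong : ∀ xs {f g : A → ℕ} → (∀ x → f x ≡ g x) → ∑ xs f ≡ ∑ xs g
  ∑-cong []       f≗g = refl
  ∑-cong (x ∷ xs) f≗g = cong₂ _+_ (f≗g x) (∑-cong xs f≗g)

  ∑-zero : ∀ xs → ∑ xs (λ _ → 0) ≡ 0
  ∑-zero []       = refl
  ∑-zero (x ∷ xs) = ∑-zero xs

  ∑-+ : ∀ xs (f g : A → ℕ) → ∑ xs (λ x → f x + g x) ≡ ∑ xs f + ∑ xs g
  ∑-+ []       f g = refl
  ∑-+ (x ∷ xs) f g = trans (cong (f x + g x +_) (∑-+ xs f g)) (+-+-comm (f x) (g x) _ _)
    where
    +-+-comm : ∀ a b c d → a + b + (c + d) ≡ a + c + (b + d)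
    +-+-comm = solve-∀

  ∑∑-even : (f : A → A → ℕ) → (∀ x y → f x y ≡ f y x) → (∀ x → 2 ∣ f x x) →
            ∀ xs → 2 ∣ ∑ xs (λ x → ∑ xs (f x))
  ∑∑-even f f-sym f-diag []       = 2 ∣0
  ∑∑-even f f-sym f-diag (w ∷ xs) =
    subst (2 ∣_) (sym split)
      (∣m∣n⇒∣m+n (∣m∣n⇒∣m+n (f-diag w) (divides row (+-*2 row))) (∑∑-even f f-sym f-diag xs))
    where
    open ≡-Reasoning
    row = ∑ xs (f w)
    rest = ∑ xs (λ x → ∑ xs (f x))
    +-*2 : ∀ n → n + n ≡ n * 2
    +-*2 = solve-∀
    regroup : ∀ a u v t → a + u + (v + t) ≡ a + (u + v) + t
    regroup = solve-∀
    split : f w w + row + ∑ xs (λ x → f x w + ∑ xs (f x)) ≡ f w w + (row + row) + rest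
    split = begin
      f w w + row + ∑ xs (λ x → f x w + ∑ xs (f x))    ≡⟨ cong (f w w + row +_) (∑-+ xs (λ x → f x w) _) ⟩
      f w w + row + (∑ xs (λ x → f x w) + rest)       ≡⟨ regroup (f w w) row _ rest ⟩
      f w w + (row + ∑ xs (λ x → f x w)) + rest       ≡⟨ cong (λ c → f w w + (row + c) + rest) (∑-cong xs (λ x → f-sym x w)) ⟩
      f w w + (row + row) + rest                      ∎

∑-map : ∀ {A B : Set} (h : A → B) xs (f : B → ℕ) → ∑ (map h xs) f ≡ ∑ xs (f ∘ h)
∑-map h []       f = refl
∑-map h (x ∷ xs) f = cong (f (h x) +_) (∑-map h xs f)

∑-swap : ∀ {A B : Set} xs ys (f : A → B → ℕ) → ∑ xs (λ x → ∑ ys (f x)) ≡ ∑ ys (λ y → ∑ xs (λ x → f x y))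
∑-swap []       ys f = sym (∑-zero ys)
∑-swap (x ∷ xs) ys f = trans (cong (∑ ys (f x) +_) (∑-swap xs ys f)) (sym (∑-+ ys (f x) _))

𝟙 : ∀ {p} {P : Set p} → Dec P → ℕ
𝟙 (yes _) = 1
𝟙 (no _)  = 0

𝟙-⇔ : ∀ {p q} {P : Set p} {Q : Set q} → (P → Q) → (Q → P) → (P? : Dec P) (Q? : Dec Q) → 𝟙 P? ≡ 𝟙 Q?
𝟙-⇔ P→Q Q→P (yes _) (yes _) = refl
𝟙-⇔ P→Q Q→P (no _)  (no _)  = refl
𝟙-⇔ P→Q Q→P (yes p) (no ¬q) = contradiction (P→Q p) ¬q
𝟙-⇔ P→Q Q→P (no ¬p) (yes q) = contradiction (Q→P q) ¬p

𝟙-no : ∀ {p} {P : Set p} → ¬ P → (P? : Dec P) → 𝟙 P? ≡ 0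
𝟙-no ¬p (yes p) = contradiction p ¬p
𝟙-no ¬p (no _)  = refl

module _ {A : Set} {p} {P : Pred A p} (P? : Decidable P) where

  count : List A → ℕ
  count xs = length (filter P? xs)

  count≡∑𝟙 : ∀ xs → count xs ≡ ∑ xs (𝟙 ∘ P?)
  count≡∑𝟙 []       = refl
  count≡∑𝟙 (x ∷ xs) with P? x
  ... | yes _ = cong suc (count≡∑𝟙 xs)
  ... | no _  = count≡∑𝟙 xs

  count-++ : ∀ xs ys → count (xs ++ ys) ≡ count xs + count ys
  count-++ xs ys = trans (cong length (filter-++ P? xs ys)) (length-++ (filter P? xs))

  count-concatMap : ∀ {I : Set} (f : I → List A) is → count (concatMap f is) ≡ ∑ is (count ∘ f)
  count-concatMap f []       = refl
  count-concatMap f (i ∷ is) = trans (count-++ (f i) (concatMap f is)) (cong (count (f i) +_) (count-concatMap f is))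

module _ {A : Set} {ℓ} {Q : Pred (A × A) ℓ} (Q? : Decidable Q)
         (Q-swap : ∀ {x y} → Q (x , y) → Q (y , x)) (Q-irrefl : ∀ {x} → ¬ Q (x , x)) where

  private
    pairCount : List A → List A → ℕ
    pairCount xs ys = ∑ xs (λ x → ∑ ys (λ y → 𝟙 (Q? (x , y))))

    count-pairs : ∀ xs ys → count Q? (concatMap (λ x → map (x ,_) ys) xs) ≡ pairCount xs ys
    count-pairs xs ys = trans (count-concatMap Q? (λ x → map (x ,_) ys) xs)
      (∑-cong xs (λ x → trans (count≡∑𝟙 Q? (map (x ,_) ys)) (∑-map (x ,_) ys (𝟙 ∘ Q?))))

    pairCount-sym : ∀ xs ys → pairCount xs ys ≡ pairCount ys xs
    pairCount-sym xs ys = trans (∑-swap xs ys _)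
      (∑-cong ys (λ y → ∑-cong xs (λ x → 𝟙-⇔ Q-swap Q-swap (Q? (x , y)) (Q? (y , x)))))

    pairCount-diagonal-even : ∀ xs → 2 ∣ pairCount xs xs
    pairCount-diagonal-even = ∑∑-even (λ x y → 𝟙 (Q? (x , y)))
      (λ x y → 𝟙-⇔ Q-swap Q-swap (Q? (x , y)) (Q? (y , x)))
      (λ x → subst (2 ∣_) (sym (𝟙-no Q-irrefl (Q? (x , x)))) (2 ∣0))

  -- The block counts pairCount (B i) (B j) form a symmetric matrix whose diagonal is even
  -- by the same argument one level down.
  count-swap-closed-irreflexive-even : ∀ {I : Set} (B : I → List A) (is : List I) →
    2 ∣ count Q? (concatMap (λ i → concatMap (λ j → concatMap (λ x → map (x ,_) (B j)) (B i)) is) is)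
  count-swap-closed-irreflexive-even B is =
    subst (2 ∣_) (sym count≡∑∑)
      (∑∑-even (λ i j → pairCount (B i) (B j)) (λ i j → pairCount-sym (B i) (B j))
               (λ i → pairCount-diagonal-even (B i)) is)
    where
    count≡∑∑ : count Q? (concatMap (λ i → concatMap (λ j → concatMap (λ x → map (x ,_) (B j)) (B i)) is) is)
           ≡ ∑ is (λ i → ∑ is (λ j → pairCount (B i) (B j)))
    count≡∑∑ = trans (count-concatMap Q? _ is)
      (∑-cong is (λ i → trans (count-concatMap Q? _ is) (∑-cong is (λ j → count-pairs (B i) (B j)))))

module _ {A : Set} {p} {P : Pred A p} (P? : Decidable P) (r : ℕ) where

  private
    applyUpTo-+ : ∀ (g : ℕ → A) k m → applyUpTo g (k + m) ≡ applyUpTo g k ++ applyUpTo (λ i → g (k + i)) m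
    applyUpTo-+ g zero    m = refl
    applyUpTo-+ g (suc k) m = cong (g 0 ∷_) (applyUpTo-+ (g ∘ suc) k m)

    count-initial : ∀ (g : ℕ → A) k → (∀ {i} → i < k → P (g i)) → count P? (applyUpTo g k) ≡ k
    count-initial g k hits = trans (cong length (filter-all P? (applyUpTo⁺₁ g k hits))) (length-applyUpTo g k)

    Hits : (ℕ → A) → Set p
    Hits g = ∀ i → suc r ∤ suc i → P (g i)

    Hits⇒initial : ∀ {g} → Hits g → ∀ {i} → i < r → P (g i)
    Hits⇒initial hits {i} i<r = hits i (>⇒∤ (s≤s i<r))

    count-block : ∀ g → (∀ {i} → i < r → P (g i)) → ∀ m →
                  r + count P? (applyUpTo (λ i → g (r + suc i)) m) ≤ count P? (applyUpTo g (r + suc m))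
    count-block g initial m = begin
      r + count P? rest                                                   ≡⟨ cong (_+ count P? rest) (count-initial g r initial) ⟨
      count P? (applyUpTo g r) + count P? rest                            ≤⟨ +-monoʳ-≤ (count P? (applyUpTo g r)) (m≤n+m _ (count P? [ g (r + 0) ])) ⟩
      count P? (applyUpTo g r) + (count P? [ g (r + 0) ] + count P? rest) ≡⟨ cong (count P? (applyUpTo g r) +_) (count-++ P? [ g (r + 0) ] rest) ⟨
      count P? (applyUpTo g r) + count P? (g (r + 0) ∷ rest)              ≡⟨ count-++ P? (applyUpTo g r) _ ⟨
      count P? (applyUpTo g r ++ applyUpTo (λ i → g (r + i)) (suc m))     ≡⟨ cong (count P?) (applyUpTo-+ g r (suc m)) ⟨
      count P? (applyUpTo g (r + suc m))                                  ∎
      where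
      open ≤-Reasoning
      rest = applyUpTo (λ i → g (r + suc i)) m

    blocks : ∀ g → Hits g → ∀ q s → s ≤ r → r * (q * suc r + s) ≤ suc r * count P? (applyUpTo g (q * suc r + s))
    blocks g hits zero s s≤r = begin
      r * s                               ≤⟨ *-monoˡ-≤ s (n≤1+n r) ⟩
      suc r * s                           ≡⟨ cong (suc r *_) (count-initial g s (λ i<s → Hits⇒initial hits (≤-trans i<s s≤r))) ⟨
      suc r * count P? (applyUpTo g s)    ∎
      where open ≤-Reasoning
    blocks g hits (suc q) s s≤r = begin
      r * (suc r + q * suc r + s)                            ≡⟨ distribute r (q * suc r) s ⟩
      suc r * r + r * m                                      ≤⟨ +-monoʳ-≤ (suc r * r) (blocks g′ hits′ q s s≤r) ⟩
      suc r * r + suc r * count P? (applyUpTo g′ m)          ≡⟨ *-distribˡ-+ (suc r) r _ ⟨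
      suc r * (r + count P? (applyUpTo g′ m))                ≤⟨ *-monoʳ-≤ (suc r) (count-block g (Hits⇒initial hits) m) ⟩
      suc r * count P? (applyUpTo g (r + suc m))             ≡⟨ cong (λ k → suc r * count P? (applyUpTo g k)) length-eq ⟩
      suc r * count P? (applyUpTo g (suc r + q * suc r + s)) ∎
      where
      open ≤-Reasoning
      m = q * suc r + s
      g′ : ℕ → A
      g′ i = g (r + suc i)
      -- suc (r + suc i) is definitionally suc r + suc i, so g′ stays aligned with the period.
      hits′ : Hits g′
      hits′ i r+1∤i+1 = hits (r + suc i) (λ r+1∣ → r+1∤i+1 (∣m+n∣m⇒∣n r+1∣ ∣-refl))
      distribute : ∀ r x s → r * (suc r + x + s) ≡ suc r * r + r * (x + s)
      distribute = solve-∀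
      length-eq : r + suc m ≡ suc r + q * suc r + s
      length-eq = trans (+-suc r m) (cong suc (sym (+-assoc r (q * suc r) s)))

  count-applyUpTo-≥ : ∀ (g : ℕ → A) → (∀ i → suc r ∤ suc i → P (g i)) →
                      ∀ n → r * n ≤ suc r * count P? (applyUpTo g n)
  count-applyUpTo-≥ g hits n =
    subst (λ k → r * k ≤ suc r * count P? (applyUpTo g k)) (sym n≡)
      (blocks g hits (n / suc r) (n % suc r) (s≤s⁻¹ (m%n<n n (suc r))))
    where
    n≡ : n ≡ n / suc r * suc r + n % suc r
    n≡ = trans (m≡m%n+[m/n]*n n (suc r)) (+-comm (n % suc r) _)

sum-replicate : ∀ k c → sum (replicate k c) ≡ k * c
sum-replicate zero    c = refl
sum-replicate (suc k) c = cong (c +_) (sum-replicate k c)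

m%n≡r⇒m≡r+n*[m/n] : ∀ {m n r} .{{_ : NonZero n}} → m % n ≡ r → m ≡ r + n * (m / n)
m%n≡r⇒m≡r+n*[m/n] {m} {n} m%n≡r = trans (m≡m%n+[m/n]*n m n) (cong₂ _+_ m%n≡r (*-comm (m / n) n))

IsCop-swap : ∀ {a m n γ σ} → IsCop a a m n (γ , σ) → IsCop a a m n (σ , γ)
IsCop-swap {a} {m} {n} {γ} {σ} (okγ , okσ , size) = okσ , okγ , trans size-swap size
  where
  open ≡-Reasoning
  swap : ∀ x y k l m → y + k * (m * l) + x ≡ x + l * (m * k) + y
  swap = solve-∀
  size-swap : sum σ + sum (rhoOf m σ γ) + sum γ ≡ sum γ + sum (rhoOf m γ σ) + sum σ
  size-swap = begin
    sum σ + sum (rhoOf m σ γ) + sum γ                      ≡⟨ cong (λ ρ → sum σ + ρ + sum γ) (sum-replicate (length γ) _) ⟩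
    sum σ + length γ * (m * length σ) + sum γ              ≡⟨ swap (sum γ) (sum σ) (length γ) (length σ) m ⟩
    sum γ + length σ * (m * length γ) + sum σ              ≡⟨ cong (λ ρ → sum γ + ρ + sum σ) (sum-replicate (length σ) _) ⟨
    sum γ + sum (rhoOf m γ σ) + sum σ                      ∎

Odd : ℕ → Set
Odd x = ∃[ k ] x ≡ 1 + 2 * k

PartOK-odd : ∀ a′ {m x} → 2 ∣ m → PartOK (1 + 2 * a′) m x → Odd x
PartOK-odd a′ {m} {x} 2∣m (c≤x , m∣x∸c) with ∣-trans 2∣m m∣x∸c
... | divides t x∸c≡t*2 = t + a′ , (begin
  x                          ≡⟨ m∸n+n≡m c≤x ⟨
  x ∸ (1 + 2 * a′) + (1 + 2 * a′) ≡⟨ cong (_+ (1 + 2 * a′)) x∸c≡t*2 ⟩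
  t * 2 + (1 + 2 * a′)        ≡⟨ collect t a′ ⟩
  1 + 2 * (t + a′)            ∎)
  where
  open ≡-Reasoning
  collect : ∀ t a′ → t * 2 + (1 + 2 * a′) ≡ 1 + 2 * (t + a′)
  collect = solve-∀

sum-odd : ∀ {xs} → All Odd xs → ∃[ s ] sum xs ≡ length xs + 2 * s
sum-odd []                = 0 , refl
sum-odd (_∷_ {x} {xs} (k , x≡) odds) with sum-odd odds
... | s , sum≡ = k + s , trans (cong₂ _+_ x≡ sum≡) (collect k (length xs) s)
  where
  collect : ∀ k l s → 1 + 2 * k + (l + 2 * s) ≡ 1 + l + 2 * (k + s)
  collect = solve-∀

2∣n+n*n : ∀ n → 2 ∣ n + n * n
2∣n+n*n zero    = 2 ∣0
2∣n+n*n (suc n) = subst (2 ∣_) (sym (step n)) (∣m∣n⇒∣m+n (2∣n+n*n n) (m∣m*n (1 + n)))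
  where
  step : ∀ n → suc n + suc n * suc n ≡ n + n * n + 2 * (1 + n)
  step = solve-∀

IsCop-diagonal-4∣ : ∀ a′ q {n γ} → IsCop (1 + 2 * a′) (1 + 2 * a′) (2 + 4 * q) n (γ , γ) → 4 ∣ n
IsCop-diagonal-4∣ a′ q {n} {γ} (okγ , _ , size) =
  subst (4 ∣_) size≡ (∣m∣n⇒∣m+n (*-monoʳ-∣ 2 (2∣n+n*n k)) (m∣m*n (s + q * (k * k))))
  where
  open ≡-Reasoning
  k = length γ
  2∣m : 2 ∣ 2 + 4 * q
  2∣m = ∣m∣n⇒∣m+n ∣-refl (∣-trans (m∣m*n 2) (m∣m*n q))
  parts-odd : ∃[ s ] sum γ ≡ k + 2 * s
  parts-odd = sum-odd (All.map (PartOK-odd a′ 2∣m) okγ)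
  s = proj₁ parts-odd
  expand : ∀ k s q → k + 2 * s + k * ((2 + 4 * q) * k) + (k + 2 * s) ≡ 2 * (k + k * k) + 4 * (s + q * (k * k))
  expand = solve-∀
  size≡ : 2 * (k + k * k) + 4 * (s + q * (k * k)) ≡ n
  size≡ = begin
    2 * (k + k * k) + 4 * (s + q * (k * k))                       ≡⟨ expand k s q ⟨
    k + 2 * s + k * ((2 + 4 * q) * k) + (k + 2 * s)               ≡⟨ cong₂ (λ x ρ → x + ρ + x) (proj₂ parts-odd) (sum-replicate k _) ⟨
    sum γ + sum (rhoOf (2 + 4 * q) γ γ) + sum γ                   ≡⟨ size ⟩
    n                                                             ∎

cp-even : ∀ a m {n} → a % 2 ≡ 1 → m % 4 ≡ 2 → 4 ∤ n → 2 ∣ cp a a m n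
cp-even a m {n} a%2≡1 m%4≡2 4∤n =
  count-swap-closed-irreflexive-even (isCop? a a m n) IsCop-swap (4∤n ∘ diagonal) partitions (upTo (suc n))
  where
  diagonal : ∀ {γ} → IsCop a a m n (γ , γ) → 4 ∣ n
  diagonal {γ} = IsCop-diagonal-4∣ (a / 2) (m / 4)
               ∘ subst₂ (λ a m → IsCop a a m n (γ , γ)) (m%n≡r⇒m≡r+n*[m/n] {a} {2} a%2≡1) (m%n≡r⇒m≡r+n*[m/n] {m} {4} m%4≡2)

corollary3p6 : (a m : ℕ) → a % 2 ≡ 1 → m % 4 ≡ 2 →
    (d : ℕ) → ∃[ N ] ((n : ℕ) → N ≤ n →
      3 * suc d * n ≤ 4 * suc d * evenCount a m n + 4 * n)
corollary3p6 a m a%2≡1 m%4≡2 d = 0 , λ n _ → begin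
  3 * suc d * n                                ≡⟨ reassoc 3 (suc d) n ⟩
  suc d * (3 * n)                              ≤⟨ *-monoʳ-≤ (suc d) (three-quarters n) ⟩
  suc d * (4 * evenCount a m n)                ≡⟨ reassoc 4 (suc d) (evenCount a m n) ⟨
  4 * suc d * evenCount a m n                  ≤⟨ m≤m+n _ (4 * n) ⟩
  4 * suc d * evenCount a m n + 4 * n          ∎
  where
  open ≤-Reasoning
  reassoc : ∀ x y z → x * y * z ≡ y * (x * z)
  reassoc = solve-∀
  three-quarters : ∀ n → 3 * n ≤ 4 * evenCount a m n
  three-quarters n = count-applyUpTo-≥ (λ k → 2 ∣? cp a a m k) 3 suc (λ i 4∤ → cp-even a m a%2≡1 m%4≡2 4∤) n
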